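{- Let $\alpha,\beta,\gamma,x\in\mathbb{N}_0$ with $(\alpha,\beta,\gamma,x)\neq(0,0,0,0)$ and let $\lambda\in\mathbb{N}_0$. Then for every integer $n\ge0$, $$A^{\lambda,x}_{n+1}(\alpha,\beta,\gamma)=\gamma\, A^{\lambda,x}_{n}(\alpha,\beta,\gamma+\alpha)+\sum_{k=0}^{n}\binom{n}{k}A^{0,x}_k(\alpha,\beta,\gamma)\,A^{\lambda,x}_{n-k+1}(\alpha,\beta,0).$$
   Context: For a number $\alpha$ and integer $n\ge0$, $(t|\alpha)_n=t(t-\alpha)\cdots(t-(n-1)\alpha)$, $(t|\alpha)_0=1$. For numbers $\alpha,\beta,\gamma$ the generalised Stirling numbers $S(n,k,\alpha,\beta,\gamma)$, $0\le k\le n$, are defined by the polynomial identity $(t|\alpha)_n=\sum_{k=0}^{n}S(n,k,\alpha,\beta,\gamma)(t-\gamma|\beta)_k$. For a number $\lambda$ and integer $k\ge0$, $\binom{k+\lambda-1}{k}=\lambda(\lambda+1)\cdots(\lambda+k-1)/k!$ (equal to $1$ for $k=0$; in particular $\binom{k-1}{k}=0$ for $k\ge1$). Define $$A^{\lambda,x}_n(\alpha,\beta,\gamma)=\sum_{k=0}^{n}\binom{k+\lambda-1}{k}(-1)^{n+k}\beta^k k!\,S(n,k,\alpha,-\beta,-\gamma)\,x^k.$$ -}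

module Defs where

open import Data.Nat as ℕ using (ℕ; zero; suc; _∸_)
open import Data.Nat.Combinatorics using (_C_)
open import Data.Integer using (ℤ; +_; _+_; _*_; _-_; -_; _^_; -1ℤ; 0ℤ; 1ℤ)
open import Relation.Binary.PropositionalEquality using (_≡_)

fall : ℤ → ℤ → ℕ → ℤ
fall t a zero    = 1ℤ
fall t a (suc n) = fall t a n * (t - (+ n) * a)

sumTo : ℕ → (ℕ → ℤ) → ℤ
sumTo zero    f = f 0
sumTo (suc n) f = sumTo n f + f (suc n)

-- The paper *defines* these by the
-- polynomial identity (t|a)_n = Σ_{k=0}^n S(n,k,a,b,c) (t-c|b)_k.
-- Since the (t-c|b)_k are monic of degree k, the coefficients are uniquely
-- determined, and a polynomial identity over ℤ is equivalent to equality
-- of values at all integers t.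
IsGenStirling : (ℕ → ℕ → ℤ → ℤ → ℤ → ℤ) → Set
IsGenStirling S =
  ∀ (n : ℕ) (a b c t : ℤ) →
    fall t a n ≡ sumTo n (λ k → S n k a b c * fall (t - c) b k)

-- binom(k+λ-1, k) = λ(λ+1)...(λ+k-1)/k!  for λ ∈ ℕ.
-- For λ ≥ 1 this is the ordinary binomial; for λ = 0 the truncated
-- subtraction gives (k-1 C k) = 0 for k ≥ 1 and (0 C 0) = 1 for k = 0.
risingBinom : ℕ → ℕ → ℕ
risingBinom lam k = (k ℕ.+ lam ∸ 1) C k

A : (ℕ → ℕ → ℤ → ℤ → ℤ → ℤ) → ℕ → ℕ → ℕ → ℕ → ℕ → ℕ → ℤ
A S lam x n α β γ =
  sumTo n (λ k →
    + risingBinom lam k * (-1ℤ ^ (n ℕ.+ k)) * ((+ β) ^ k) * (+ (k ℕ.!))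
      * S n k (+ α) (- (+ β)) (- (+ γ)) * ((+ x) ^ k))

module Submission where

-- Write S_c(n,k) for the coefficients of (t|α)_n in the basis (t-c|-β)_k. They obey a triangular
-- recurrence in n, and for β ≠ 0 (for column 0 always) they are determined by evaluating at the
-- nodes t = c - jβ. Splitting the binomial convolution S_c(n,k) = Σ_j C(n,j) (c|α)_j S_0(n-j,k) by
-- Pascal's rule gives
--   S_c(n+1,k) = c S_{c-α}(n,k) + Σ_j C(n,j) (c|α)_j S_0(n+1-j,k).
-- Weighting by (-1)^{n+1+k} binom(k+λ-1,k) β^k k! x^k and summing over k yields the recurrence
-- with c = -γ, because A^{0,x}_j collapses to its k = 0 term (-1)^j (c|α)_j.

open import Defs
open import Data.Nat using (ℕ; zero; suc; _∸_; _≤_; _<_; z≤n; s≤s; _!)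
import Data.Nat as ℕ
import Data.Nat.Properties as ℕ
open import Data.Nat.Combinatorics using (_C_; nCk+nC[k+1]≡[n+1]C[k+1]; k>n⇒nCk≡0)
open import Data.Integer using (ℤ; +_; _+_; _*_; _-_; -_; _^_; -1ℤ; 0ℤ; 1ℤ)
import Data.Integer.Properties as ℤ
open import Data.Integer.Tactic.RingSolver using (solve-∀)
open import Data.Product using (_×_)
open import Data.Sum using (inj₁; inj₂)
open import Data.Empty using (⊥-elim)
open import Function using (_∘_)
open import Relation.Nullary using (¬_; yes; no)
open import Relation.Binary.Definitions using (tri<; tri≈; tri>)
open import Relation.Binary.PropositionalEquality
  using (_≡_; _≢_; refl; sym; trans; cong; cong₂; module ≡-Reasoning)

sumTo-cong : ∀ n {f g : ℕ → ℤ} → (∀ k → k ≤ n → f k ≡ g k) → sumTo n f ≡ sumTo n g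
sumTo-cong zero    f≗g = f≗g 0 z≤n
sumTo-cong (suc n) f≗g =
  cong₂ _+_ (sumTo-cong n (λ k k≤n → f≗g k (ℕ.m≤n⇒m≤1+n k≤n))) (f≗g (suc n) ℕ.≤-refl)

sumTo-zero : ∀ n {f : ℕ → ℤ} → (∀ k → k ≤ n → f k ≡ 0ℤ) → sumTo n f ≡ 0ℤ
sumTo-zero zero    f≡0 = f≡0 0 z≤n
sumTo-zero (suc n) f≡0 =
  cong₂ _+_ (sumTo-zero n (λ k k≤n → f≡0 k (ℕ.m≤n⇒m≤1+n k≤n))) (f≡0 (suc n) ℕ.≤-refl)

sumTo-+ : ∀ n (f g : ℕ → ℤ) → sumTo n (λ k → f k + g k) ≡ sumTo n f + sumTo n g
sumTo-+ zero    f g = refl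
sumTo-+ (suc n) f g = trans (cong (_+ (f (suc n) + g (suc n))) (sumTo-+ n f g))
                            (interchange (sumTo n f) (sumTo n g) (f (suc n)) (g (suc n)))
  where
  interchange : ∀ a b c d → (a + b) + (c + d) ≡ (a + c) + (b + d)
  interchange = solve-∀

sumTo-- : ∀ n (f g : ℕ → ℤ) → sumTo n (λ k → f k - g k) ≡ sumTo n f - sumTo n g
sumTo-- zero    f g = refl
sumTo-- (suc n) f g = trans (cong (_+ (f (suc n) - g (suc n))) (sumTo-- n f g))
                            (interchange (sumTo n f) (sumTo n g) (f (suc n)) (g (suc n)))
  where
  interchange : ∀ a b c d → (a - b) + (c - d) ≡ (a + c) - (b + d)
  interchange = solve-∀

*-distribˡ-sumTo : ∀ n c (f : ℕ → ℤ) → c * sumTo n f ≡ sumTo n (λ k → c * f k)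
*-distribˡ-sumTo zero    c f = refl
*-distribˡ-sumTo (suc n) c f =
  trans (ℤ.*-distribˡ-+ c (sumTo n f) (f (suc n))) (cong (_+ c * f (suc n)) (*-distribˡ-sumTo n c f))

sumTo-suc-head : ∀ n (f : ℕ → ℤ) → sumTo (suc n) f ≡ f 0 + sumTo n (f ∘ suc)
sumTo-suc-head zero    f = refl
sumTo-suc-head (suc n) f = trans (cong (_+ f (suc (suc n))) (sumTo-suc-head n f)) (ℤ.+-assoc (f 0) _ _)

sumTo-swap : ∀ m n (f : ℕ → ℕ → ℤ) →
             sumTo m (λ i → sumTo n (f i)) ≡ sumTo n (λ j → sumTo m (λ i → f i j))
sumTo-swap zero    n f = refl
sumTo-swap (suc m) n f = trans (cong (_+ sumTo n (f (suc m))) (sumTo-swap m n f))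
                               (sym (sumTo-+ n (λ j → sumTo m (λ i → f i j)) (f (suc m))))

sumTo-extend : ∀ d n {f : ℕ → ℤ} → (∀ k → n < k → f k ≡ 0ℤ) → sumTo (d ℕ.+ n) f ≡ sumTo n f
sumTo-extend zero    n f≡0 = refl
sumTo-extend (suc d) n f≡0 =
  trans (cong₂ _+_ (sumTo-extend d n f≡0) (f≡0 (suc (d ℕ.+ n)) (s≤s (ℕ.m≤n+m n d))))
        (ℤ.+-identityʳ _)

sumTo-single : ∀ n j (f : ℕ → ℤ) → j ≤ n → (∀ k → k ≤ n → k ≢ j → f k ≡ 0ℤ) → sumTo n f ≡ f j
sumTo-single zero    zero    f z≤n f≡0 = refl
sumTo-single (suc n) j       f j≤1+n f≡0 with ℕ.m≤n⇒m<n∨m≡n j≤1+n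
... | inj₁ (s≤s j≤n) =
  trans (cong₂ _+_ (sumTo-single n j f j≤n (λ k k≤n → f≡0 k (ℕ.m≤n⇒m≤1+n k≤n)))
                   (f≡0 (suc n) ℕ.≤-refl (λ { refl → ℕ.1+n≰n j≤n })))
        (ℤ.+-identityʳ _)
... | inj₂ refl =
  trans (cong (_+ f (suc n)) (sumTo-zero n (λ k k≤n → f≡0 k (ℕ.m≤n⇒m≤1+n k≤n) (λ { refl → ℕ.1+n≰n k≤n }))))
        (ℤ.+-identityˡ _)

shift : (ℕ → ℤ) → ℕ → ℤ
shift f zero    = 0ℤ
shift f (suc k) = f k

sumTo-shift : ∀ n (f g : ℕ → ℤ) → sumTo (suc n) (λ k → shift f k * g k) ≡ sumTo n (λ k → f k * g (suc k))
sumTo-shift n f g = trans (sumTo-suc-head n _) (ℤ.+-identityˡ _)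

-- The binomial convolution (product of exponential generating functions); ⋆-suc is its Leibniz rule.
_⋆_ : (ℕ → ℤ) → (ℕ → ℤ) → ℕ → ℤ
(u ⋆ v) n = sumTo n (λ j → + (n C j) * u j * v (n ∸ j))

⋆-suc : ∀ (u v : ℕ → ℤ) n → (u ⋆ v) (suc n) ≡ (u ⋆ (v ∘ suc)) n + ((u ∘ suc) ⋆ v) n
⋆-suc u v n = begin
  (u ⋆ v) (suc n)
    ≡⟨ sumTo-suc-head n _ ⟩
  term 0 + sumTo n (λ i → + (suc n C suc i) * u (suc i) * v (n ∸ i))
    ≡⟨ cong (λ s → term 0 + s) (sumTo-cong n (λ i _ → pascal i)) ⟩
  term 0 + sumTo n (λ i → term (suc i) + + (n C i) * u (suc i) * v (n ∸ i))
    ≡⟨ cong (λ s → term 0 + s) (sumTo-+ n (term ∘ suc) _) ⟩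
  term 0 + (sumTo n (term ∘ suc) + ((u ∘ suc) ⋆ v) n)
    ≡⟨ sym (ℤ.+-assoc (term 0) _ _) ⟩
  (term 0 + sumTo n (term ∘ suc)) + ((u ∘ suc) ⋆ v) n
    ≡⟨ cong (_+ ((u ∘ suc) ⋆ v) n) (sym (sumTo-suc-head n term)) ⟩
  sumTo (1 ℕ.+ n) term + ((u ∘ suc) ⋆ v) n
    ≡⟨ cong (_+ ((u ∘ suc) ⋆ v) n) (sumTo-extend 1 n term-vanishes) ⟩
  sumTo n term + ((u ∘ suc) ⋆ v) n
    ≡⟨ cong (_+ ((u ∘ suc) ⋆ v) n) (sumTo-cong n (λ i i≤n →
         cong (λ m → + (n C i) * u i * v m) (ℕ.+-∸-assoc 1 i≤n))) ⟩
  (u ⋆ (v ∘ suc)) n + ((u ∘ suc) ⋆ v) n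
    ∎
  where
  open ≡-Reasoning
  term : ℕ → ℤ
  term i = + (n C i) * u i * v (suc n ∸ i)
  term-vanishes : ∀ i → n < i → term i ≡ 0ℤ
  term-vanishes i n<i rewrite k>n⇒nCk≡0 n<i = refl
  split : ∀ p q r s → (p + q) * r * s ≡ q * r * s + p * r * s
  split = solve-∀
  pascal : ∀ i → + (suc n C suc i) * u (suc i) * v (n ∸ i)
                 ≡ term (suc i) + + (n C i) * u (suc i) * v (n ∸ i)
  pascal i rewrite sym (nCk+nC[k+1]≡[n+1]C[k+1] n i) | ℤ.pos-+ (n C i) (n C suc i) =
    split (+ (n C i)) (+ (n C suc i)) (u (suc i)) (v (n ∸ i))

⋆-scaleˡ : ∀ c (u v : ℕ → ℤ) n → ((λ j → c * u j) ⋆ v) n ≡ c * (u ⋆ v) n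
⋆-scaleˡ c u v n = trans (sumTo-cong n (λ j _ → reassoc c (+ (n C j)) (u j) (v (n ∸ j))))
                         (sym (*-distribˡ-sumTo n c _))
  where
  reassoc : ∀ c p q r → p * (c * q) * r ≡ c * (p * q * r)
  reassoc = solve-∀

⋆-congˡ : ∀ {u u′ : ℕ → ℤ} (v : ℕ → ℤ) n → (∀ j → u j ≡ u′ j) → (u ⋆ v) n ≡ (u′ ⋆ v) n
⋆-congˡ v n u≗u′ = sumTo-cong n (λ j _ → cong (λ z → + (n C j) * z * v (n ∸ j)) (u≗u′ j))

fall-suc-head : ∀ t s n → fall t s (suc n) ≡ t * fall (t - s) s n
fall-suc-head t s zero    = base t s
  where
  base : ∀ t s → 1ℤ * (t - 0ℤ * s) ≡ t * 1ℤ
  base = solve-∀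
fall-suc-head t s (suc n) =
  trans (cong (_* (t - + suc n * s)) (fall-suc-head t s n)) (step t s (fall (t - s) s n) (+ n))
  where
  step : ∀ t s p n → t * p * (t - (1ℤ + n) * s) ≡ t * (p * ((t - s) - n * s))
  step = solve-∀

module Stirling (a b : ℤ) where

  factor : ℤ → ℕ → ℕ → ℤ
  factor c n k = c + + k * b - + n * a

  -- stirling c n k is S(n,k,a,b,c); the recurrence comes from t - n a = ((t - c) - k b) + factor c n k.
  stirling : ℤ → ℕ → ℕ → ℤ
  stirling c zero    zero    = 1ℤ
  stirling c zero    (suc k) = 0ℤ
  stirling c (suc n) k       = shift (stirling c n) k + factor c n k * stirling c n k

  stirling-vanishes : ∀ c n k → n < k → stirling c n k ≡ 0ℤ
  stirling-vanishes c zero    (suc k) _         = refl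
  stirling-vanishes c (suc n) (suc k) (s≤s n<k)
    rewrite stirling-vanishes c n k n<k | stirling-vanishes c n (suc k) (ℕ.m<n⇒m<1+n n<k) =
    trans (ℤ.+-identityˡ _) (ℤ.*-zeroʳ (factor c n (suc k)))

  fall-step : ∀ c t n k → (t - + n * a) * fall (t - c) b k
                          ≡ fall (t - c) b (suc k) + factor c n k * fall (t - c) b k
  fall-step c t n k = identity c t (+ n) (+ k) (fall (t - c) b k) a b
    where
    identity : ∀ c t n k p a b → (t - n * a) * p ≡ p * ((t - c) - k * b) + (c + k * b - n * a) * p
    identity = solve-∀

  fall-expansion : ∀ c t n → fall t a n ≡ sumTo n (λ k → stirling c n k * fall (t - c) b k)
  fall-expansion c t zero    = refl
  fall-expansion c t (suc n) = begin
    fall t a n * (t - + n * a)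
      ≡⟨ cong (_* (t - + n * a)) (fall-expansion c t n) ⟩
    sumTo n (λ k → S k * p k) * (t - + n * a)
      ≡⟨ trans (ℤ.*-comm _ (t - + n * a)) (*-distribˡ-sumTo n (t - + n * a) _) ⟩
    sumTo n (λ k → (t - + n * a) * (S k * p k))
      ≡⟨ sumTo-cong n (λ k _ → multiply-step k) ⟩
    sumTo n (λ k → S k * p (suc k) + factor c n k * S k * p k)
      ≡⟨ sumTo-+ n _ _ ⟩
    sumTo n (λ k → S k * p (suc k)) + sumTo n (λ k → factor c n k * S k * p k)
      ≡⟨ cong₂ _+_ (sym (sumTo-shift n S p)) (sym (sumTo-extend 1 n top-vanishes)) ⟩
    sumTo (suc n) (λ k → shift S k * p k) + sumTo (suc n) (λ k → factor c n k * S k * p k)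
      ≡⟨ sym (sumTo-+ (suc n) _ _) ⟩
    sumTo (suc n) (λ k → shift S k * p k + factor c n k * S k * p k)
      ≡⟨ sumTo-cong (suc n) (λ k _ → sym (ℤ.*-distribʳ-+ (p k) (shift S k) (factor c n k * S k))) ⟩
    sumTo (suc n) (λ k → stirling c (suc n) k * p k)
      ∎
    where
    open ≡-Reasoning
    p = fall (t - c) b
    S = stirling c n
    multiply-step : ∀ k → (t - + n * a) * (S k * p k) ≡ S k * p (suc k) + factor c n k * S k * p k
    multiply-step k = begin
      (t - + n * a) * (S k * p k)          ≡⟨ swap (t - + n * a) (S k) (p k) ⟩
      S k * ((t - + n * a) * p k)          ≡⟨ cong (S k *_) (fall-step c t n k) ⟩
      S k * (p (suc k) + factor c n k * p k) ≡⟨ expand (S k) (p (suc k)) (factor c n k) (p k) ⟩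
      S k * p (suc k) + factor c n k * S k * p k ∎
      where
      swap : ∀ x y z → x * (y * z) ≡ y * (x * z)
      swap = solve-∀
      expand : ∀ s q f r → s * (q + f * r) ≡ s * q + f * s * r
      expand = solve-∀
    top-vanishes : ∀ k → n < k → factor c n k * S k * p k ≡ 0ℤ
    top-vanishes k n<k rewrite stirling-vanishes c n k n<k | ℤ.*-zeroʳ (factor c n k) = refl

  fall-node≡0 : ∀ j m → j < m → fall (+ j * b) b m ≡ 0ℤ
  fall-node≡0 j (suc m) j<1+m with ℕ.m<1+n⇒m<n∨m≡n j<1+m
  ... | inj₁ j<m  rewrite fall-node≡0 j m j<m = refl
  ... | inj₂ refl rewrite ℤ.+-inverseʳ (+ j * b) = ℤ.*-zeroʳ (fall (+ j * b) b j)

  fall-node≢0 : b ≢ 0ℤ → ∀ j m → m ≤ j → fall (+ j * b) b m ≢ 0ℤ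
  fall-node≢0 b≢0 j zero    _   ()
  fall-node≢0 b≢0 j (suc m) m<j eq with ℤ.i*j≡0⇒i≡0∨j≡0 (fall (+ j * b) b m) eq
  ... | inj₁ fall≡0   = fall-node≢0 b≢0 j m (ℕ.<⇒≤ m<j) fall≡0
  ... | inj₂ factor≡0 with ℤ.i*j≡0⇒i≡0∨j≡0 (+ j - + m) (trans (factorise (+ j) (+ m) b) factor≡0)
    where
    factorise : ∀ j m b → (j - m) * b ≡ j * b - m * b
    factorise = solve-∀
  ...   | inj₁ j-m≡0 = ℕ.<⇒≢ m<j (sym (ℤ.+-injective (ℤ.i-j≡0⇒i≡j (+ j) (+ m) j-m≡0)))
  ...   | inj₂ b≡0   = b≢0 b≡0

  IsNullCombination : ℕ → ℤ → (ℕ → ℤ) → Set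
  IsNullCombination n c d = ∀ t → sumTo n (λ k → d k * fall (t - c) b k) ≡ 0ℤ

  -- Evaluating at t = c + j b kills every basis polynomial of degree above j.
  null-coefficient : ∀ n c d → IsNullCombination n c d → ∀ j → j ≤ n →
                     (∀ i → i < j → d i ≡ 0ℤ) → fall (+ j * b) b j ≢ 0ℤ → d j ≡ 0ℤ
  null-coefficient n c d null j j≤n lower fall≢0 with ℤ.i*j≡0⇒i≡0∨j≡0 (d j) at-node
    where
    others-vanish : ∀ k → k ≤ n → k ≢ j → d k * fall (+ j * b) b k ≡ 0ℤ
    others-vanish k _ k≢j with ℕ.<-cmp k j
    ... | tri< k<j _ _ rewrite lower k k<j = refl
    ... | tri≈ _ k≡j _ = ⊥-elim (k≢j k≡j)
    ... | tri> _ _ j<k rewrite fall-node≡0 j k j<k = ℤ.*-zeroʳ (d k)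
    cancel : ∀ c x → (c + x) - c ≡ x
    cancel = solve-∀
    at-node : d j * fall (+ j * b) b j ≡ 0ℤ
    at-node = begin
      d j * fall (+ j * b) b j
        ≡⟨ sumTo-single n j _ j≤n others-vanish ⟨
      sumTo n (λ k → d k * fall (+ j * b) b k)
        ≡⟨ sumTo-cong n (λ k _ → cong (λ t → d k * fall t b k) (cancel c (+ j * b))) ⟨
      sumTo n (λ k → d k * fall ((c + + j * b) - c) b k)
        ≡⟨ null (c + + j * b) ⟩
      0ℤ ∎
      where open ≡-Reasoning
  ... | inj₁ dj≡0   = dj≡0
  ... | inj₂ fall≡0 = ⊥-elim (fall≢0 fall≡0)

  null-combination-trivial : b ≢ 0ℤ → ∀ n c d → IsNullCombination n c d → ∀ k → k ≤ n → d k ≡ 0ℤ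
  null-combination-trivial b≢0 n c d null k k≤n =
    null-coefficient n c d null k k≤n (below k k≤n) (fall-node≢0 b≢0 k k ℕ.≤-refl)
    where
    below : ∀ j → j ≤ n → ∀ i → i < j → d i ≡ 0ℤ
    below (suc j) 1+j≤n i i<1+j with ℕ.m<1+n⇒m<n∨m≡n i<1+j
    ... | inj₁ i<j  = below j (ℕ.<⇒≤ 1+j≤n) i i<j
    ... | inj₂ refl = null-combination-trivial b≢0 n c d null j (ℕ.<⇒≤ 1+j≤n)

  module _ (S : ℕ → ℕ → ℤ → ℤ → ℤ → ℤ) (isS : IsGenStirling S) where

    discrepancy : ℤ → ℕ → ℕ → ℤ
    discrepancy c n k = S n k a b c - stirling c n k

    IsGenStirling⇒null-discrepancy : ∀ c n → IsNullCombination n c (discrepancy c n)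
    IsGenStirling⇒null-discrepancy c n t = begin
      sumTo n (λ k → (S n k a b c - stirling c n k) * p k)
        ≡⟨ sumTo-cong n (λ k _ → distrib (S n k a b c) (stirling c n k) (p k)) ⟩
      sumTo n (λ k → S n k a b c * p k - stirling c n k * p k)
        ≡⟨ sumTo-- n _ _ ⟩
      sumTo n (λ k → S n k a b c * p k) - sumTo n (λ k → stirling c n k * p k)
        ≡⟨ cong₂ _-_ (isS n a b c t) (fall-expansion c t n) ⟨
      fall t a n - fall t a n
        ≡⟨ ℤ.+-inverseʳ (fall t a n) ⟩
      0ℤ ∎
      where
      open ≡-Reasoning
      p = fall (t - c) b
      distrib : ∀ x y q → (x - y) * q ≡ x * q - y * q
      distrib = solve-∀

    IsGenStirling⇒≡stirling₀ : ∀ c n → S n 0 a b c ≡ stirling c n 0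
    IsGenStirling⇒≡stirling₀ c n =
      ℤ.i-j≡0⇒i≡j _ _
        (null-coefficient n c (discrepancy c n) (IsGenStirling⇒null-discrepancy c n) 0 z≤n (λ _ ()) (λ ()))

    IsGenStirling⇒≡stirling : b ≢ 0ℤ → ∀ c n k → k ≤ n → S n k a b c ≡ stirling c n k
    IsGenStirling⇒≡stirling b≢0 c n k k≤n =
      ℤ.i-j≡0⇒i≡j _ _
        (null-combination-trivial b≢0 n c (discrepancy c n) (IsGenStirling⇒null-discrepancy c n) k k≤n)

  stirling-column₀ : ∀ c n → stirling c n 0 ≡ fall c a n
  stirling-column₀ c zero    = refl
  stirling-column₀ c (suc n) rewrite stirling-column₀ c n = identity c (+ n) a b (fall c a n)
    where
    identity : ∀ c n a b p → 0ℤ + (c + 0ℤ * b - n * a) * p ≡ p * (c - n * a)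
    identity = solve-∀

  factor₀-∸ : ∀ c n j k → j ≤ n → factor 0ℤ (n ∸ j) k ≡ factor c n k - (c - + j * a)
  factor₀-∸ c n j k j≤n =
    trans (cong (λ m → 0ℤ + + k * b - m * a) +[n∸j]≡+n-+j) (identity c (+ n) (+ j) (+ k) a b)
    where
    +[n∸j]≡+n-+j : + (n ∸ j) ≡ + n - + j
    +[n∸j]≡+n-+j = trans (sym (ℤ.⊖-≥ j≤n)) (sym (ℤ.m-n≡m⊖n n j))
    identity : ∀ c n j k a b → 0ℤ + k * b - (n - j) * a ≡ (c + k * b - n * a) - (c - j * a)
    identity = solve-∀

  stirling-convolution : ∀ c n k → stirling c n k ≡ (fall c a ⋆ (λ m → stirling 0ℤ m k)) n
  stirling-convolution c zero    zero    = refl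
  stirling-convolution c zero    (suc k) = refl
  stirling-convolution c (suc n) k       = sym (begin
    (fall c a ⋆ column) (suc n)
      ≡⟨ ⋆-suc (fall c a) column n ⟩
    (fall c a ⋆ (column ∘ suc)) n + ((fall c a ∘ suc) ⋆ column) n
      ≡⟨ sumTo-+ n _ _ ⟨
    sumTo n (λ j → + (n C j) * fall c a j * column (suc (n ∸ j)) + + (n C j) * fall c a (suc j) * column (n ∸ j))
      ≡⟨ sumTo-cong n recurrence ⟩
    sumTo n (λ j → + (n C j) * fall c a j * shift (stirling 0ℤ (n ∸ j)) k
                   + factor c n k * (+ (n C j) * fall c a j * column (n ∸ j)))
      ≡⟨ sumTo-+ n _ _ ⟩
    sumTo n (λ j → + (n C j) * fall c a j * shift (stirling 0ℤ (n ∸ j)) k)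
      + sumTo n (λ j → factor c n k * (+ (n C j) * fall c a j * column (n ∸ j)))
      ≡⟨ cong₂ _+_ (shifted-convolution k) (sym (*-distribˡ-sumTo n (factor c n k) _)) ⟩
    shift (stirling c n) k + factor c n k * (fall c a ⋆ column) n
      ≡⟨ cong (λ s → shift (stirling c n) k + factor c n k * s) (stirling-convolution c n k) ⟨
    stirling c (suc n) k ∎)
    where
    open ≡-Reasoning
    column : ℕ → ℤ
    column m = stirling 0ℤ m k
    shifted-convolution : ∀ k → sumTo n (λ j → + (n C j) * fall c a j * shift (stirling 0ℤ (n ∸ j)) k)
                                ≡ shift (stirling c n) k
    shifted-convolution zero    = sumTo-zero n (λ j _ → ℤ.*-zeroʳ (+ (n C j) * fall c a j))
    shifted-convolution (suc k) = sym (stirling-convolution c n k)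
    identity : ∀ C f h F g s → C * f * (h + (F - g) * s) + C * (f * g) * s ≡ C * f * h + F * (C * f * s)
    identity = solve-∀
    recurrence : ∀ j → j ≤ n →
      + (n C j) * fall c a j * column (suc (n ∸ j)) + + (n C j) * fall c a (suc j) * column (n ∸ j)
      ≡ + (n C j) * fall c a j * shift (stirling 0ℤ (n ∸ j)) k + factor c n k * (+ (n C j) * fall c a j * column (n ∸ j))
    recurrence j j≤n =
      trans (cong (λ e → + (n C j) * fall c a j * (shift (stirling 0ℤ (n ∸ j)) k + e * column (n ∸ j))
                         + + (n C j) * fall c a (suc j) * column (n ∸ j))
                  (factor₀-∸ c n j k j≤n))
            (identity (+ (n C j)) (fall c a j) (shift (stirling 0ℤ (n ∸ j)) k) (factor c n k)
                      (c - + j * a) (column (n ∸ j)))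

  stirling-suc : ∀ c n k → stirling c (suc n) k
                           ≡ c * stirling (c - a) n k + (fall c a ⋆ (λ m → stirling 0ℤ (suc m) k)) n
  stirling-suc c n k = begin
    stirling c (suc n) k
      ≡⟨ stirling-convolution c (suc n) k ⟩
    (fall c a ⋆ column) (suc n)
      ≡⟨ ⋆-suc (fall c a) column n ⟩
    (fall c a ⋆ (column ∘ suc)) n + ((fall c a ∘ suc) ⋆ column) n
      ≡⟨ cong (_+_ rest) (⋆-congˡ column n (fall-suc-head c a)) ⟩
    (fall c a ⋆ (column ∘ suc)) n + ((λ j → c * fall (c - a) a j) ⋆ column) n
      ≡⟨ cong (_+_ rest) (⋆-scaleˡ c (fall (c - a) a) column n) ⟩
    (fall c a ⋆ (column ∘ suc)) n + c * (fall (c - a) a ⋆ column) n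
      ≡⟨ cong (λ s → rest + c * s) (stirling-convolution (c - a) n k) ⟨
    (fall c a ⋆ (column ∘ suc)) n + c * stirling (c - a) n k
      ≡⟨ ℤ.+-comm rest _ ⟩
    c * stirling (c - a) n k + (fall c a ⋆ (column ∘ suc)) n ∎
    where
    open ≡-Reasoning
    column : ℕ → ℤ
    column m = stirling 0ℤ m k
    rest : ℤ
    rest = (fall c a ⋆ (column ∘ suc)) n

sign : ℕ → ℤ
sign m = -1ℤ ^ m

sign-suc : ∀ m → sign (suc m) ≡ - sign m
sign-suc m = ℤ.-1*i≡-i (sign m)

sign-+ : ∀ m n → sign (m ℕ.+ n) ≡ sign m * sign n
sign-+ = ℤ.^-distribˡ-+-* -1ℤ

j+suc[n∸j]≡suc[n] : ∀ n j → j ≤ n → j ℕ.+ suc (n ∸ j) ≡ suc n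
j+suc[n∸j]≡suc[n] n j j≤n = trans (ℕ.+-suc j (n ∸ j)) (cong suc (ℕ.m+[n∸m]≡n j≤n))

module Coefficients (α β x : ℕ) where

  open Stirling (+ α) (- + β)

  weight : ℕ → ℕ → ℤ
  weight lam k = + risingBinom lam k * (+ β) ^ k * + (k !) * (+ x) ^ k

  summand : ℕ → ℤ → ℕ → ℕ → ℤ
  summand lam c n k = sign (n ℕ.+ k) * (weight lam k * stirling c n k)

  -- A^{lam,x}_n(α,β,-c) computed with the explicit Stirling numbers, for any integer shift c.
  Aˢ : ℕ → ℤ → ℕ → ℤ
  Aˢ lam c n = sumTo n (summand lam c n)

  Aˢ-extend : ∀ d lam c n → sumTo (d ℕ.+ n) (summand lam c n) ≡ Aˢ lam c n
  Aˢ-extend d lam c n = sumTo-extend d n summand-vanishes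
    where
    summand-vanishes : ∀ k → n < k → summand lam c n k ≡ 0ℤ
    summand-vanishes k n<k rewrite stirling-vanishes c n k n<k | ℤ.*-zeroʳ (weight lam k) =
      ℤ.*-zeroʳ (sign (n ℕ.+ k))

  weight₀-suc : ∀ k → weight 0 (suc k) ≡ 0ℤ
  weight₀-suc k rewrite k>n⇒nCk≡0 {k ℕ.+ 0} {suc k} (s≤s (ℕ.≤-reflexive (ℕ.+-identityʳ k))) = refl

  Aˢ₀ : ∀ c j → Aˢ 0 c j ≡ sign j * fall c (+ α) j
  Aˢ₀ c j = begin
    Aˢ 0 c j                                 ≡⟨ sumTo-single j 0 (summand 0 c j) z≤n higher-vanish ⟩
    sign (j ℕ.+ 0) * (1ℤ * stirling c j 0)   ≡⟨ cong₂ (λ m s → sign m * s) (ℕ.+-identityʳ j) (ℤ.*-identityˡ _) ⟩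
    sign j * stirling c j 0                  ≡⟨ cong (sign j *_) (stirling-column₀ c j) ⟩
    sign j * fall c (+ α) j                  ∎
    where
    open ≡-Reasoning
    higher-vanish : ∀ k → k ≤ j → k ≢ 0 → summand 0 c j k ≡ 0ℤ
    higher-vanish zero    _ 0≢0 = ⊥-elim (0≢0 refl)
    higher-vanish (suc k) _ _   rewrite weight₀-suc k = ℤ.*-zeroʳ (sign (j ℕ.+ suc k))

  module _ (S : ℕ → ℕ → ℤ → ℤ → ℤ → ℤ) (isS : IsGenStirling S) where

    -- For β = 0 the columns k ≥ 1 are not determined by IsGenStirling, but then β^k kills them.
    β-power-agrees : ∀ c n k → k ≤ n → (+ β) ^ k * S n k (+ α) (- + β) c ≡ (+ β) ^ k * stirling c n k
    β-power-agrees c n zero    _   = cong (1ℤ *_) (IsGenStirling⇒≡stirling₀ S isS c n)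
    β-power-agrees c n (suc k) k≤n with β ℕ.≟ 0
    ... | yes β≡0 = trans (vanishes _) (sym (vanishes _))
      where
      vanishes : ∀ z → (+ β) ^ suc k * z ≡ 0ℤ
      vanishes z = cong (λ b → (+ b) ^ suc k * z) β≡0
    ... | no β≢0  = cong ((+ β) ^ suc k *_)
                         (IsGenStirling⇒≡stirling S isS (β≢0 ∘ ℤ.+-injective ∘ ℤ.neg-injective) c n (suc k) k≤n)

    A≡Aˢ : ∀ lam n γ → A S lam x n α β γ ≡ Aˢ lam (- + γ) n
    A≡Aˢ lam n γ = sumTo-cong n (λ k k≤n → begin
      + risingBinom lam k * sign (n ℕ.+ k) * (+ β) ^ k * + (k !) * S n k (+ α) (- + β) (- + γ) * (+ x) ^ k
        ≡⟨ regroup (+ risingBinom lam k) (sign (n ℕ.+ k)) ((+ β) ^ k) (+ (k !)) _ ((+ x) ^ k) ⟩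
      sign (n ℕ.+ k) * (+ risingBinom lam k * ((+ β) ^ k * S n k (+ α) (- + β) (- + γ)) * + (k !) * (+ x) ^ k)
        ≡⟨ cong (λ z → sign (n ℕ.+ k) * (+ risingBinom lam k * z * + (k !) * (+ x) ^ k))
                (β-power-agrees (- + γ) n k k≤n) ⟩
      sign (n ℕ.+ k) * (+ risingBinom lam k * ((+ β) ^ k * stirling (- + γ) n k) * + (k !) * (+ x) ^ k)
        ≡⟨ cong (sign (n ℕ.+ k) *_) (regroup′ (+ risingBinom lam k) ((+ β) ^ k) (+ (k !)) ((+ x) ^ k) _) ⟩
      summand lam (- + γ) n k ∎)
      where
      open ≡-Reasoning
      regroup : ∀ r s p f z y → r * s * p * f * z * y ≡ s * (r * (p * z) * f * y)
      regroup = solve-∀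
      regroup′ : ∀ r p f y z → r * (p * z) * f * y ≡ r * p * f * y * z
      regroup′ = solve-∀

  Aˢ-suc : ∀ lam c n → Aˢ lam c (suc n)
           ≡ - c * Aˢ lam (c - + α) n + sumTo n (λ j → + (n C j) * Aˢ 0 c j * Aˢ lam 0ℤ (suc (n ∸ j)))
  Aˢ-suc lam c n = begin
    Aˢ lam c (suc n)
      ≡⟨ sumTo-cong (suc n) (λ k _ → split k) ⟩
    sumTo (suc n) (λ k → - c * summand lam (c - + α) n k + sign (suc n ℕ.+ k) * weight lam k * tail k)
      ≡⟨ sumTo-+ (suc n) _ _ ⟩
    sumTo (suc n) (λ k → - c * summand lam (c - + α) n k)
      + sumTo (suc n) (λ k → sign (suc n ℕ.+ k) * weight lam k * tail k)
      ≡⟨ cong₂ _+_ shifted convolved ⟩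
    - c * Aˢ lam (c - + α) n + sumTo n (λ j → + (n C j) * Aˢ 0 c j * Aˢ lam 0ℤ (suc (n ∸ j))) ∎
    where
    open ≡-Reasoning
    tail : ℕ → ℤ
    tail k = (fall c (+ α) ⋆ (λ m → stirling 0ℤ (suc m) k)) n

    identity : ∀ s w c t v → - s * (w * (c * t + v)) ≡ - c * (s * (w * t)) + - s * w * v
    identity = solve-∀
    split : ∀ k → summand lam c (suc n) k
                  ≡ - c * summand lam (c - + α) n k + sign (suc n ℕ.+ k) * weight lam k * tail k
    split k rewrite stirling-suc c n k | sign-suc (n ℕ.+ k) =
      identity (sign (n ℕ.+ k)) (weight lam k) c (stirling (c - + α) n k) (tail k)

    shifted : sumTo (suc n) (λ k → - c * summand lam (c - + α) n k) ≡ - c * Aˢ lam (c - + α) n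
    shifted = trans (sym (*-distribˡ-sumTo (suc n) (- c) _)) (cong (- c *_) (Aˢ-extend 1 lam (c - + α) n))

    regroup : ∀ sj sm w b f z → sj * sm * w * (b * f * z) ≡ b * (sj * f) * (sm * (w * z))
    regroup = solve-∀
    factorise : ∀ j → j ≤ n →
      sumTo (suc n) (λ k → sign (suc n ℕ.+ k) * weight lam k
                             * (+ (n C j) * fall c (+ α) j * stirling 0ℤ (suc (n ∸ j)) k))
      ≡ + (n C j) * Aˢ 0 c j * Aˢ lam 0ℤ (suc (n ∸ j))
    factorise j j≤n = begin
      sumTo (suc n) (λ k → sign (suc n ℕ.+ k) * weight lam k * (+ (n C j) * fall c (+ α) j * stirling 0ℤ m k))
        ≡⟨ sumTo-cong (suc n) (λ k _ → separate k) ⟩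
      sumTo (suc n) (λ k → + (n C j) * (sign j * fall c (+ α) j) * summand lam 0ℤ m k)
        ≡⟨ *-distribˡ-sumTo (suc n) (+ (n C j) * (sign j * fall c (+ α) j)) (summand lam 0ℤ m) ⟨
      + (n C j) * (sign j * fall c (+ α) j) * sumTo (suc n) (summand lam 0ℤ m)
        ≡⟨ cong₂ (λ u v → + (n C j) * u * v) (sym (Aˢ₀ c j))
                 (trans (cong (λ l → sumTo l (summand lam 0ℤ m)) (sym (j+suc[n∸j]≡suc[n] n j j≤n)))
                        (Aˢ-extend j lam 0ℤ m)) ⟩
      + (n C j) * Aˢ 0 c j * Aˢ lam 0ℤ m ∎
      where
      m = suc (n ∸ j)
      separate : ∀ k → sign (suc n ℕ.+ k) * weight lam k * (+ (n C j) * fall c (+ α) j * stirling 0ℤ m k)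
                       ≡ + (n C j) * (sign j * fall c (+ α) j) * summand lam 0ℤ m k
      separate k rewrite cong (λ l → sign (l ℕ.+ k)) (sym (j+suc[n∸j]≡suc[n] n j j≤n))
                       | ℕ.+-assoc j m k | sign-+ j (m ℕ.+ k) =
        regroup (sign j) (sign (m ℕ.+ k)) (weight lam k) (+ (n C j)) (fall c (+ α) j) (stirling 0ℤ m k)

    convolved : sumTo (suc n) (λ k → sign (suc n ℕ.+ k) * weight lam k * tail k)
                ≡ sumTo n (λ j → + (n C j) * Aˢ 0 c j * Aˢ lam 0ℤ (suc (n ∸ j)))
    convolved = begin
      sumTo (suc n) (λ k → sign (suc n ℕ.+ k) * weight lam k * tail k)
        ≡⟨ sumTo-cong (suc n) (λ k _ → *-distribˡ-sumTo n (sign (suc n ℕ.+ k) * weight lam k) _) ⟩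
      sumTo (suc n) (λ k → sumTo n (λ j → sign (suc n ℕ.+ k) * weight lam k
                                          * (+ (n C j) * fall c (+ α) j * stirling 0ℤ (suc (n ∸ j)) k)))
        ≡⟨ sumTo-swap (suc n) n _ ⟩
      sumTo n (λ j → sumTo (suc n) (λ k → sign (suc n ℕ.+ k) * weight lam k
                                          * (+ (n C j) * fall c (+ α) j * stirling 0ℤ (suc (n ∸ j)) k)))
        ≡⟨ sumTo-cong n factorise ⟩
      sumTo n (λ j → + (n C j) * Aˢ 0 c j * Aˢ lam 0ℤ (suc (n ∸ j))) ∎

mainTheorem2 : (S : ℕ → ℕ → ℤ → ℤ → ℤ → ℤ) → IsGenStirling S →
    (α β γ x lam : ℕ) → ¬ (α ≡ 0 × β ≡ 0 × γ ≡ 0 × x ≡ 0) →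
    (n : ℕ) →
    A S lam x (suc n) α β γ
      ≡ (+ γ) * A S lam x n α β (γ Data.Nat.+ α)
        + sumTo n (λ k → + (n C k) * A S 0 x k α β γ * A S lam x (suc (n ∸ k)) α β 0)
mainTheorem2 S isS α β γ x lam _ n = begin
  A S lam x (suc n) α β γ
    ≡⟨ A≡Aˢ S isS lam (suc n) γ ⟩
  Aˢ lam (- + γ) (suc n)
    ≡⟨ Aˢ-suc lam (- + γ) n ⟩
  - - + γ * Aˢ lam (- + γ - + α) n + convolution
    ≡⟨ cong (_+ convolution) (cong₂ _*_ (ℤ.neg-involutive (+ γ)) (cong (λ c → Aˢ lam c n) -γ-α≡-[γ+α])) ⟩
  + γ * Aˢ lam (- + (γ ℕ.+ α)) n + convolution
    ≡⟨ cong₂ (λ a s → + γ * a + s) (A≡Aˢ S isS lam n (γ ℕ.+ α))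
             (sumTo-cong n (λ k _ → cong₂ (λ u v → + (n C k) * u * v)
                                          (A≡Aˢ S isS 0 k γ) (A≡Aˢ S isS lam (suc (n ∸ k)) 0))) ⟨
  + γ * A S lam x n α β (γ ℕ.+ α)
    + sumTo n (λ k → + (n C k) * A S 0 x k α β γ * A S lam x (suc (n ∸ k)) α β 0) ∎
  where
  open ≡-Reasoning
  open Coefficients α β x
  convolution : ℤ
  convolution = sumTo n (λ k → + (n C k) * Aˢ 0 (- + γ) k * Aˢ lam 0ℤ (suc (n ∸ k)))
  -γ-α≡-[γ+α] : - + γ - + α ≡ - + (γ ℕ.+ α)
  -γ-α≡-[γ+α] = trans (sym (ℤ.neg-distrib-+ (+ γ) (+ α))) (cong -_ (sym (ℤ.pos-+ γ α)))
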